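{- Let $M_1=(X,\mathcal{I}_1)$ be a matroid and $M_2,\ldots,M_k$ partition matroids on $X$; let $\alpha=\chi(M_1)$ and $B=\sum_{i=2}^k(\chi(M_i)-1)$. Let $c$ be a feasible coloring of some elements of $M=\bigcap_{i=1}^kM_i$ with colors in $[\alpha+B]$, $G$ the Edmonds digraph of $M_1$ with respect to $c$ (with $\alpha+B$ colors), and $H$ the color-chordless subgraph of $G$. Let $P_j=(x_{\ell-j},x_{\ell-j+1},\ldots,x_\ell=u)$ be a path in $H$ ending at an uncolored element $u$, whose first vertex $x_{\ell-j}$ is an element of $X$ (not a color vertex), and which is suffix-feasible with respect to each of $M_2,\ldots,M_k$. Then there is a vertex $z$ of $H$ such that $(z,x_{\ell-j})$ is an arc of $H$ and $P_{j+1}=(z,x_{\ell-j},\ldots,x_\ell=u)$ is suffix-feasible with respect to each of $M_2,\ldots,M_k$.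
   Context: Partition matroid: a partition of $X$ into parts with positive integer capacities; a set is independent iff it meets each part in at most its capacity. Coloring $c:X\to\{0,\ldots,\alpha+B\}$, $0$ meaning uncolored; color classes $S_j=\{x:c(x)=j\}$; a coloring is feasible in a matroid if each color class is independent there. Edmonds digraph $G=(V,A)$: $V=[\alpha+B]\cup X$, $A=\bigcup_jA_j$, where $A_j$ contains $(j,x)$ for each $x\notin S_j$ with $S_j\cup\{x\}\in\mathcal{I}_1$, and, for each $x\notin S_j$ with $S_j\cup\{x\}\notin\mathcal{I}_1$, the arc $(y,x)$ for each $y\in S_j$ with $S_j-\{y\}\cup\{x\}\in\mathcal{I}_1$. Color of color vertex $j$ is $j$; color of element $x$ is $c(x)$. Color-chordless subgraph $H$: layers $L_0=[\alpha+B]$ (no entering arcs), and inductively $L_t$ = vertices not in earlier layers having incoming arcs in $G$ from earlier-layer vertices of at least $B+1$ distinct colors; for each such $x$ choose $y_1,\ldots,y_{B+1}$ in earlier layers, of pairwise distinct colors, with $(y_s,x)\in A$, such that no vertex $z$ of the same color as $y_s$ in a layer earlier than $y_s$'s has $(z,x)\in A$; the arcs $(y_s,x)$ are the arcs of $H$ entering $x$; continue until no vertex qualifies. For a path $P=(x_1,\ldots,x_\ell=u)$ in $G$ ending at an uncolored $u$, $c\,\Delta\,P$ colors $x_t$ with $c(x_{t-1})$ for $3\le t\le\ell$; if $x_1$ is a color vertex then $x_2$ gets color $x_1$; otherwise $x_2$ gets color $c(x_1)$ and $x_1$ becomes uncolored; all else as in $c$. $P$ is suffix-feasible with respect to a matroid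 $N$ if for every suffix $(x_{\ell-s},\ldots,x_\ell)$ of $P$ ($s\ge0$), $c\,\Delta$ (that suffix) is a feasible coloring in $N$. -}

module Defs where

open import Data.Nat using (ℕ; zero; suc; _+_; _∸_; _≤_; _<_)
open import Data.Bool using (Bool; true; false)
open import Data.Fin using (Fin)
open import Data.Fin.Properties renaming (_≟_ to _≟F_)
open import Data.Fin.Subset using (Subset; _∈_; _∉_; _⊆_; _∪_; _∩_; ⁅_⁆; ∣_∣; ∁) renaming (⊥ to ∅)
open import Data.Vec using (tabulate)
open import Data.Maybe using (Maybe; just; nothing)
import Data.Maybe.Properties as MP
open import Data.List using (List; []; _∷_; length; drop; map; allFin)
open import Data.Nat.ListAction using (sum)
open import Data.Unit using (⊤)
open import Data.Sum using (_⊎_; inj₁; inj₂)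
open import Data.Product using (Σ; ∃; _×_; _,_)
open import Data.Empty using (⊥)
open import Relation.Nullary using (¬_; Dec; does; yes; no)
open import Relation.Unary using (Decidable)
open import Relation.Binary.PropositionalEquality using (_≡_)
open import Function using (Injective)

record Matroid (n : ℕ) : Set₁ where
  field
    Indep      : Subset n → Set
    Indep?     : Decidable Indep
    indep-∅    : Indep ∅
    indep-↓    : ∀ {S T} → S ⊆ T → Indep T → Indep S
    indep-aug  : ∀ {S T} → Indep S → Indep T → ∣ S ∣ < ∣ T ∣ →
                 ∃ λ x → x ∈ T × x ∉ S × Indep (S ∪ ⁅ x ⁆)

record PartitionMatroid (n : ℕ) : Set where
  field
    #parts  : ℕ
    part    : Fin n → Fin #parts
    cap     : Fin #parts → ℕ
    cap-pos : ∀ q → 1 ≤ cap q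

  Part : Fin #parts → Subset n
  Part q = tabulate (λ x → does (part x ≟F q))

  Indep : Subset n → Set
  Indep S = ∀ q → ∣ S ∩ Part q ∣ ≤ cap q

ColorClassOf : ∀ {n k} → (Fin n → Fin k) → Fin k → Subset n
ColorClassOf f j = tabulate (λ x → does (f x ≟F j))

Colorable : ∀ {n} → (Subset n → Set) → ℕ → Set
Colorable {n} I k = Σ (Fin n → Fin k) λ f → ∀ j → I (ColorClassOf f j)

IsChromaticNumber : ∀ {n} → (Subset n → Set) → ℕ → Set
IsChromaticNumber I k = Colorable I k × (∀ m → m < k → ¬ Colorable I m)

-- Colourings with N colours: nothing = uncoloured (colour 0 in the paper),
-- just j = colour j.

Coloring : ℕ → ℕ → Set
Coloring n N = Fin n → Maybe (Fin N)

Class : ∀ {n N} → Coloring n N → Fin N → Subset n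
Class c j = tabulate (λ x → does (MP.≡-dec _≟F_ (c x) (just j)))

Feasible : ∀ {n N} → (Subset n → Set) → Coloring n N → Set
Feasible I c = ∀ j → I (Class c j)

sumPred : ∀ {m} → (Fin m → ℕ) → ℕ
sumPred {m} χs = sum (map (λ i → χs i ∸ 1) (allFin m))

-- Edmonds digraph, layers, colour-chordless subgraphs, path recolouring.
-- Vertices: inj₁ j = colour vertex j, inj₂ x = element x.

Vertex : ℕ → ℕ → Set
Vertex n N = Fin N ⊎ Fin n

update : ∀ {n N} → Coloring n N → Fin n → Maybe (Fin N) → Coloring n N
update c a v x with x ≟F a
... | yes _ = v
... | no _  = c x

module Edmonds {n N : ℕ} (M₁ : Matroid n) (B : ℕ) (c : Coloring n N) where
  open Matroid M₁

  S : Fin N → Subset n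
  S = Class c

  colorOf : Vertex n N → Maybe (Fin N)
  colorOf (inj₁ j) = just j
  colorOf (inj₂ x) = c x

  Arc : Vertex n N → Vertex n N → Set
  Arc (inj₁ j) (inj₂ x) = x ∉ S j × Indep (S j ∪ ⁅ x ⁆)
  Arc (inj₂ y) (inj₂ x) = ∃ λ j → x ∉ S j × ¬ Indep (S j ∪ ⁅ x ⁆)
                                  × y ∈ S j × Indep ((S j ∩ ∁ ⁅ y ⁆) ∪ ⁅ x ⁆)
  Arc _        (inj₁ _) = ⊥

  ManyColors : (Vertex n N → Set) → Vertex n N → Set
  ManyColors Earlier v =
    Σ (Fin (suc B) → Vertex n N) λ y →
      (∀ s → Earlier (y s)) × (∀ s → Arc (y s) v) × Injective _≡_ _≡_ (λ s → colorOf (y s))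

  -- InLayer t v : v ∈ L_t ;  Before t v : v ∈ L_0 ∪ … ∪ L_{t-1}
  InLayer : ℕ → Vertex n N → Set
  Before  : ℕ → Vertex n N → Set
  InLayer zero    (inj₁ _) = ⊤
  InLayer zero    (inj₂ _) = ⊥
  InLayer (suc t) v = ¬ Before (suc t) v × ManyColors (Before (suc t)) v
  Before zero    v = ⊥
  Before (suc t) v = Before t v ⊎ InLayer t v

  IsColorChordless : (Vertex n N → Vertex n N → Set) → Set
  IsColorChordless HArc =
    ∀ x →
      ((∀ t → ¬ InLayer (suc t) x) → ∀ w → ¬ HArc w x)
      × (∀ t → InLayer (suc t) x →
           Σ (Fin (suc B) → Vertex n N) λ y →
             (∀ s → Before (suc t) (y s))
             × (∀ s → Arc (y s) x)
             × Injective _≡_ _≡_ (λ s → colorOf (y s))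
             × (∀ s → ∃ λ tₛ → InLayer tₛ (y s)
                  × (∀ z → colorOf z ≡ colorOf (y s) → Before tₛ z → ¬ Arc z x))
             × (∀ w → (HArc w x → ∃ λ s → w ≡ y s) × (∀ s → w ≡ y s → HArc w x)))

  IsWalk : (Vertex n N → Vertex n N → Set) → List (Vertex n N) → Set
  IsWalk R []           = ⊤
  IsWalk R (v ∷ [])     = ⊤
  IsWalk R (v ∷ w ∷ vs) = R v w × IsWalk R (w ∷ vs)

  private
    setV : Vertex n N → Maybe (Fin N) → Coloring n N → Coloring n N
    setV (inj₁ _) _ d = d
    setV (inj₂ x) v d = update d x v

    go : Vertex n N → List (Vertex n N) → Coloring n N → Coloring n N
    go p []       d = d
    go p (w ∷ ws) d = go w ws (setV w (colorOf p) d)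

  Δ : List (Vertex n N) → Coloring n N
  Δ []       = c
  Δ (v ∷ vs) = go v vs (setV v nothing c)

  SuffixFeasible : (Subset n → Set) → List (Vertex n N) → Set
  SuffixFeasible I P = ∀ s → s < length P → Feasible I (Δ (drop s P))

{-# OPTIONS --safe #-}
module Submission where

-- The head a of the path lies in a layer L_{t+1}: if the path goes on, a is the tail of an
-- H-arc, and H-arcs leave only layered vertices; otherwise a = u is uncoloured, and uncoloured
-- elements are layered.  The latter is Edmonds' counting argument: each unlayered x is spanned
-- by S_j ∩ U (U the unlayered elements) for at least α colours j, while the span of an
-- independent set A has at most α∣A∣ elements, so α∣U∣ ≤ α Σ_j ∣S_j ∩ U∣, which is less than
-- α∣U∣ as soon as U contains an uncoloured element.
--
-- Colour-chordlessness then gives B + 1 in-neighbours of a in H with distinct colours.  After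
-- recolouring along the path a is uncoloured, so in each Mᵢ fewer than χᵢ colour classes are
-- saturated in the part of a: cap · #saturated ≤ #coloured elements of the part < ∣part∣ ≤ χᵢ · cap.
-- Hence at most B colours are saturated in some Mᵢ, one in-neighbour z has a colour that is
-- saturated nowhere, and giving a the colour of z keeps every Mᵢ feasible.

open import Defs
open import Data.Nat using (ℕ; _+_)
open import Data.Fin using (Fin)
open import Data.Maybe using (Maybe; just; nothing)
open import Data.List using (List; _∷_; last)
open import Data.List.Relation.Unary.Unique.Propositional using (Unique)
open import Data.Sum using (_⊎_; inj₁; inj₂)
open import Data.Product using (Σ; ∃; _×_; _,_)
open import Relation.Binary.PropositionalEquality using (_≡_)

open import Data.Bool using (if_then_else_)
open import Data.Fin using (zero; suc; toℕ; join; splitAt; inject≤)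
open import Data.Fin.Properties
  using (_≟_; any?; all?; ¬∀⟶∃¬; injective⇒≤; inject≤-injective; splitAt-join; toℕ<n; toℕ-injective; nonZeroIndex)
  renaming (suc-injective to Fin-suc-injective; 0≢1+n to Fin-0≢1+n)
open import Data.Fin.Subset using (Subset; inside; outside; _∈_; _∉_; _⊆_; _∪_; _∩_; ⁅_⁆; ∣_∣; ∁; _-_)
open import Data.Fin.Subset.Properties
  using (_∈?_; ⊆-refl; p⊆p∪q; q⊆p∪q; x∈p∪q⁻; p∩q⊆p; p∩q⊆q; x∈p∩q⁺; x∈p∩q⁻; x∈⁅x⁆; x∈⁅y⁆⇒x≡y; x∈∁p⇒x∉p;
         p⊆q⇒∣p∣≤∣q∣; p⊂q⇒∣p∣<∣q∣; x∈p⇒∣p-x∣<∣p∣; x∈p∧x≢y⇒x∈p-y; ∣p∣≤∣x∷p∣; ∣⁅x⁆∣≡1)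
open import Data.List using ([])
import Data.List as List
open import Data.List.Properties using (map-tabulate)
open import Data.List.Relation.Unary.All using (All; []; _∷_)
open import Data.List.Relation.Unary.AllPairs using (_∷_)
import Data.Maybe.Properties as Maybe
open import Data.Nat using (zero; suc; _*_; _∸_; _≤_; _<_; _≤?_; _<?_; z≤n; s≤s; s≤s⁻¹)
open import Data.Nat.ListAction using () renaming (sum to sumᴸ)
open import Data.Nat.Properties
  using (+-*-semiring; ≤-refl; ≤-reflexive; ≤-trans; ≤-antisym; <-cmp; <⇒≱; ≮⇒≥; ≰⇒>; m≤n⇒m<n∨m≡n;
         +-comm; +-suc; +-mono-≤; +-monoˡ-≤; +-monoʳ-≤; +-mono-<-≤; +-mono-≤-<; +-cancelʳ-≤; m≤m+n; m≤n+m;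
         *-comm; *-identityʳ; *-zeroʳ; *-cancelˡ-≤; *-cancelˡ-<; 0≢1+n; suc-injective; module ≤-Reasoning)
open import Data.Product using (proj₁; proj₂)
open import Algebra.Properties.Semiring.Sum +-*-semiring
  using (sum-syntax; ∑-comm; ∑-distrib-+; *-distribˡ-sum; sum-cong-≗)
open import Data.Sum using ([_,_]′)
open import Data.Unit using (tt)
open import Data.Vec using ([]; _∷_; tabulate)
open import Data.Vec.Properties using (lookup∘tabulate; []=⇒lookup; lookup⇒[]=)
open import Function using (_∘_; Injective)
open import Relation.Binary using (tri<; tri≈; tri>)
open import Relation.Binary.PropositionalEquality using (refl; sym; trans; cong; cong-app; subst; module ≡-Reasoning)
open import Relation.Nullary using (¬_; Dec; does; yes; no; ¬?; contradiction)
open import Relation.Nullary.Decidable using (_×-dec_; _⊎-dec_; map′; dec-true)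
open import Relation.Unary using (Decidable)

-- Counting over Fin m

indicator : ∀ {a} {A : Set a} → Dec A → ℕ
indicator a? = if does a? then 1 else 0

indicator-mono : ∀ {a b} {A : Set a} {B : Set b} (a? : Dec A) (b? : Dec B) →
                 (A → B) → indicator a? ≤ indicator b?
indicator-mono (yes _) (yes _) _   = ≤-refl
indicator-mono (yes a) (no ¬b) a→b = contradiction (a→b a) ¬b
indicator-mono (no _)  _       _   = z≤n

indicator-< : ∀ {a b} {A : Set a} {B : Set b} (a? : Dec A) (b? : Dec B) →
              ¬ A → B → indicator a? < indicator b?
indicator-< (yes a) _       ¬a _ = contradiction a ¬a
indicator-< (no _)  (yes _) _  _ = ≤-refl
indicator-< (no _)  (no ¬b) _  b = contradiction b ¬b

indicator+indicator¬ : ∀ {a} {A : Set a} (a? : Dec A) → indicator a? + indicator (¬? a?) ≡ 1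
indicator+indicator¬ (yes _) = refl
indicator+indicator¬ (no _)  = refl

∑-mono-≤ : ∀ {m} {f g : Fin m → ℕ} → (∀ i → f i ≤ g i) → ∑[ i < m ] f i ≤ ∑[ i < m ] g i
∑-mono-≤ {zero}  _   = z≤n
∑-mono-≤ {suc m} f≤g = +-mono-≤ (f≤g zero) (∑-mono-≤ (f≤g ∘ suc))

term≤∑ : ∀ {m} (f : Fin m → ℕ) i → f i ≤ ∑[ j < m ] f j
term≤∑ f zero    = m≤m+n (f zero) _
term≤∑ f (suc i) = ≤-trans (term≤∑ (f ∘ suc) i) (m≤n+m _ (f zero))

∑-const : ∀ m b → ∑[ i < m ] b ≡ m * b
∑-const zero    b = refl
∑-const (suc m) b = cong (b +_) (∑-const m b)

count : ∀ {m} {P : Fin m → Set} → Decidable P → ℕ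
count {m} P? = ∑[ i < m ] indicator (P? i)

count-mono : ∀ {m} {P Q : Fin m → Set} (P? : Decidable P) (Q? : Decidable Q) →
             (∀ {i} → P i → Q i) → count P? ≤ count Q?
count-mono P? Q? P⊆Q = ∑-mono-≤ (λ i → indicator-mono (P? i) (Q? i) P⊆Q)

count-< : ∀ {m} {P Q : Fin m → Set} (P? : Decidable P) (Q? : Decidable Q) →
          (∀ {i} → P i → Q i) → ∀ {x} → Q x → ¬ P x → count P? < count Q?
count-< P? Q? P⊆Q {zero} Qx ¬Px =
  +-mono-<-≤ (indicator-< (P? zero) (Q? zero) ¬Px Qx) (count-mono (P? ∘ suc) (Q? ∘ suc) P⊆Q)
count-< P? Q? P⊆Q {suc x} Qx ¬Px =
  +-mono-≤-< (indicator-mono (P? zero) (Q? zero) P⊆Q) (count-< (P? ∘ suc) (Q? ∘ suc) P⊆Q Qx ¬Px)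

count-∅ : ∀ {m} {P : Fin m → Set} (P? : Decidable P) → (∀ {i} → ¬ P i) → count P? ≡ 0
count-∅ {zero}  P? ¬P = refl
count-∅ {suc m} P? ¬P with P? zero
... | yes P0 = contradiction P0 ¬P
... | no _   = count-∅ (P? ∘ suc) ¬P

count≤1 : ∀ {m} {P : Fin m → Set} (P? : Decidable P) → (∀ {i j} → P i → P j → i ≡ j) → count P? ≤ 1
count≤1 {zero}  P? unique = z≤n
count≤1 {suc m} P? unique with P? zero
... | yes P0 = s≤s (≤-reflexive (count-∅ (P? ∘ suc) (λ P1+i → Fin-0≢1+n (unique P0 P1+i))))
... | no _   = count≤1 (P? ∘ suc) (λ Pi Pj → Fin-suc-injective (unique Pi Pj))

count-complement : ∀ {m} {P : Fin m → Set} (P? : Decidable P) → count P? + count (¬? ∘ P?) ≡ m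
count-complement {m} P? = begin
  count P? + count (¬? ∘ P?)                              ≡⟨ ∑-distrib-+ (indicator ∘ P?) (indicator ∘ ¬? ∘ P?) ⟨
  ∑[ i < m ] (indicator (P? i) + indicator (¬? (P? i)))  ≡⟨ sum-cong-≗ (indicator+indicator¬ ∘ P?) ⟩
  ∑[ i < m ] 1                                            ≡⟨ ∑-const m 1 ⟩
  m * 1                                                   ≡⟨ *-identityʳ m ⟩
  m                                                       ∎
  where open ≡-Reasoning

count-∃ : ∀ {k m} {R : Fin k → Fin m → Set} (R? : ∀ i → Decidable (R i)) →
          count (λ j → any? (λ i → R? i j)) ≤ ∑[ i < k ] count (R? i)
count-∃ {k} {m} R? = begin
  count (λ j → any? (λ i → R? i j))          ≤⟨ ∑-mono-≤ indicator-∃≤∑ ⟩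
  ∑[ j < m ] ∑[ i < k ] indicator (R? i j)  ≡⟨ ∑-comm (λ j i → indicator (R? i j)) ⟩
  ∑[ i < k ] count (R? i)                    ∎
  where
  open ≤-Reasoning
  indicator-∃≤∑ : ∀ j → indicator (any? (λ i → R? i j)) ≤ ∑[ i < k ] indicator (R? i j)
  indicator-∃≤∑ j with any? (λ i → R? i j)
  ... | yes (i , Rij) = ≤-trans (indicator-mono (yes tt) (R? i j) (λ _ → Rij)) (term≤∑ _ i)
  ... | no _          = z≤n

*-count≤∑ : ∀ {m} {P : Fin m → Set} (P? : Decidable P) b (f : Fin m → ℕ) →
            (∀ {i} → P i → b ≤ f i) → b * count P? ≤ ∑[ i < m ] f i
*-count≤∑ {m} P? b f P⇒b≤f = begin
  b * count P?                         ≡⟨ *-distribˡ-sum b (indicator ∘ P?) ⟩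
  ∑[ i < m ] (b * indicator (P? i))  ≤⟨ ∑-mono-≤ term≤f ⟩
  ∑[ i < m ] f i                       ∎
  where
  open ≤-Reasoning
  term≤f : ∀ i → b * indicator (P? i) ≤ f i
  term≤f i with P? i
  ... | yes Pi = ≤-trans (≤-reflexive (*-identityʳ b)) (P⇒b≤f Pi)
  ... | no _   = ≤-trans (≤-reflexive (*-zeroʳ b)) z≤n

rank : ∀ {m} {P : Fin m → Set} (P? : Decidable P) {x} → P x → Fin (count P?)
rank P? {zero} P0 with P? zero
... | yes _  = zero
... | no ¬P0 = contradiction P0 ¬P0
rank P? {suc x} Px with P? zero
... | yes _ = suc (rank (P? ∘ suc) Px)
... | no _  = rank (P? ∘ suc) Px

unrank : ∀ {m} {P : Fin m → Set} (P? : Decidable P) → Fin (count P?) → Fin m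
unrank {suc m} P? i with P? zero
unrank {suc m} P? zero    | yes _ = zero
unrank {suc m} P? (suc i) | yes _ = suc (unrank (P? ∘ suc) i)
unrank {suc m} P? i       | no _  = suc (unrank (P? ∘ suc) i)

unrank-satisfies : ∀ {m} {P : Fin m → Set} (P? : Decidable P) i → P (unrank P? i)
unrank-satisfies {suc m} P? i with P? zero
unrank-satisfies {suc m} P? zero    | yes P0 = P0
unrank-satisfies {suc m} P? (suc i) | yes _  = unrank-satisfies (P? ∘ suc) i
unrank-satisfies {suc m} P? i       | no _   = unrank-satisfies (P? ∘ suc) i

unrank-injective : ∀ {m} {P : Fin m → Set} (P? : Decidable P) → Injective _≡_ _≡_ (unrank P?)
unrank-injective {suc m} P? {i} {j} eq with P? zero
unrank-injective {suc m} P? {zero}  {zero}  eq | yes _ = refl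
unrank-injective {suc m} P? {suc i} {suc j} eq | yes _ =
  cong suc (unrank-injective (P? ∘ suc) (Fin-suc-injective eq))
unrank-injective {suc m} P? {i}     {j}     eq | no _  =
  unrank-injective (P? ∘ suc) (Fin-suc-injective eq)

unrank-rank : ∀ {m} {P : Fin m → Set} (P? : Decidable P) {x} (Px : P x) → unrank P? (rank P? Px) ≡ x
unrank-rank P? {zero} P0 with P? zero
... | yes _  = refl
... | no ¬P0 = contradiction P0 ¬P0
unrank-rank P? {suc x} Px with P? zero
... | yes _ = cong suc (unrank-rank (P? ∘ suc) Px)
... | no _  = cong suc (unrank-rank (P? ∘ suc) Px)

injection⇒≤count : ∀ {k m} {P : Fin m → Set} (P? : Decidable P) (g : Fin k → Fin m) →
                   Injective _≡_ _≡_ g → (∀ i → P (g i)) → k ≤ count P?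
injection⇒≤count P? g g-injective Pg = injective⇒≤ {f = λ i → rank P? (Pg i)} λ {i} {j} eq →
  g-injective (trans (sym (unrank-rank P? (Pg i))) (trans (cong (unrank P?) eq) (unrank-rank P? (Pg j))))

≤count⇒injection : ∀ {k m} {P : Fin m → Set} (P? : Decidable P) → k ≤ count P? →
                   Σ (Fin k → Fin m) λ g → Injective _≡_ _≡_ g × (∀ i → P (g i))
≤count⇒injection P? k≤ =
  (λ i → unrank P? (inject≤ i k≤)) ,
  (λ eq → inject≤-injective k≤ k≤ _ _ (unrank-injective P? eq)) ,
  (λ i → unrank-satisfies P? (inject≤ i k≤))

injection-escapes : ∀ {b m} {P : Fin m → Set} (P? : Decidable P) (g : Fin (suc b) → Fin m) →
                    Injective _≡_ _≡_ g → count P? ≤ b → ∃ λ s → ¬ P (g s)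
injection-escapes P? g g-injective count≤b with all? (P? ∘ g)
... | yes all-P = contradiction (injection⇒≤count P? g g-injective all-P) (<⇒≱ (s≤s count≤b))
... | no ¬all-P = ¬∀⟶∃¬ _ _ (P? ∘ g) ¬all-P

sum-tabulate : ∀ {m} (f : Fin m → ℕ) → sumᴸ (List.tabulate f) ≡ ∑[ i < m ] f i
sum-tabulate {zero}  f = refl
sum-tabulate {suc m} f = cong (f zero +_) (sum-tabulate (f ∘ suc))

sumPred≡∑ : ∀ {m} (χs : Fin m → ℕ) → sumPred χs ≡ ∑[ i < m ] (χs i ∸ 1)
sumPred≡∑ χs = trans (cong sumᴸ (map-tabulate (λ i → i) (λ i → χs i ∸ 1))) (sum-tabulate (λ i → χs i ∸ 1))

-- Sizes of subsets

∈-tabulate⁺ : ∀ {m} {P : Fin m → Set} (P? : Decidable P) {x} → P x → x ∈ tabulate (λ y → does (P? y))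
∈-tabulate⁺ P? {x} Px = lookup⇒[]= x _ (trans (lookup∘tabulate _ x) (dec-true (P? x) Px))

∈-tabulate⁻ : ∀ {m} {P : Fin m → Set} (P? : Decidable P) {x} → x ∈ tabulate (λ y → does (P? y)) → P x
∈-tabulate⁻ {P = P} P? {x} x∈ = from-does (P? x) (trans (sym (lookup∘tabulate _ x)) ([]=⇒lookup x∈))
  where
  from-does : (Px? : Dec (P x)) → does Px? ≡ inside → P x
  from-does (yes Px) _ = Px
  from-does (no _)   ()

∣p∣≡count-∈ : ∀ {m} (p : Subset m) → ∣ p ∣ ≡ count (_∈? p)
∣p∣≡count-∈ []            = refl
∣p∣≡count-∈ (inside  ∷ p) = cong suc (∣p∣≡count-∈ p)
∣p∣≡count-∈ (outside ∷ p) = ∣p∣≡count-∈ p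

∣tabulate∣≡count : ∀ {m} {P : Fin m → Set} (P? : Decidable P) → ∣ tabulate (λ y → does (P? y)) ∣ ≡ count P?
∣tabulate∣≡count {m} P? = trans (∣p∣≡count-∈ p) (≤-antisym (count-mono (_∈? p) P? (∈-tabulate⁻ P?))
                                                        (count-mono P? (_∈? p) (∈-tabulate⁺ P?)))
  where
  p : Subset m
  p = tabulate (λ y → does (P? y))

∣p∪q∣≤∣p∣+∣q∣ : ∀ {m} (p q : Subset m) → ∣ p ∪ q ∣ ≤ ∣ p ∣ + ∣ q ∣
∣p∪q∣≤∣p∣+∣q∣ []            []            = z≤n
∣p∪q∣≤∣p∣+∣q∣ (inside  ∷ p) (b ∷ q)       = s≤s (≤-trans (∣p∪q∣≤∣p∣+∣q∣ p q) (+-monoʳ-≤ ∣ p ∣ (∣p∣≤∣x∷p∣ b q)))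
∣p∪q∣≤∣p∣+∣q∣ (outside ∷ p) (inside  ∷ q) = ≤-trans (s≤s (∣p∪q∣≤∣p∣+∣q∣ p q)) (≤-reflexive (sym (+-suc _ _)))
∣p∪q∣≤∣p∣+∣q∣ (outside ∷ p) (outside ∷ q) = ∣p∪q∣≤∣p∣+∣q∣ p q

∣p∪⁅x⁆∣≤1+∣p∣ : ∀ {m} (p : Subset m) x → ∣ p ∪ ⁅ x ⁆ ∣ ≤ suc ∣ p ∣
∣p∪⁅x⁆∣≤1+∣p∣ p x = ≤-trans (∣p∪q∣≤∣p∣+∣q∣ p ⁅ x ⁆) (≤-reflexive (trans (cong (∣ p ∣ +_) (∣⁅x⁆∣≡1 x)) (+-comm _ 1)))

∈-Class⁺ : ∀ {n N} (d : Coloring n N) {x k} → d x ≡ just k → x ∈ Class d k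
∈-Class⁺ d {k = k} = ∈-tabulate⁺ (λ y → Maybe.≡-dec _≟_ (d y) (just k))

∈-Class⁻ : ∀ {n N} (d : Coloring n N) {x k} → x ∈ Class d k → d x ≡ just k
∈-Class⁻ d {k = k} = ∈-tabulate⁻ (λ y → Maybe.≡-dec _≟_ (d y) (just k))

∣p∣≤k*b : ∀ {n k b} (f : Fin n → Fin k) (p : Subset n) →
          (∀ j → ∣ ColorClassOf f j ∩ p ∣ ≤ b) → ∣ p ∣ ≤ k * b
∣p∣≤k*b {n} {k} {b} f p small-classes = begin
  ∣ p ∣                                                           ≡⟨ ∣p∣≡count-∈ p ⟩
  ∑[ x < n ] indicator (x ∈? p)                                   ≤⟨ ∑-mono-≤ in-own-class ⟩
  ∑[ x < n ] ∑[ j < k ] indicator (x ∈? ColorClassOf f j ∩ p)  ≡⟨ ∑-comm (λ x j → indicator (x ∈? ColorClassOf f j ∩ p)) ⟩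
  ∑[ j < k ] count (_∈? ColorClassOf f j ∩ p)                    ≡⟨ sum-cong-≗ (λ j → ∣p∣≡count-∈ (ColorClassOf f j ∩ p)) ⟨
  ∑[ j < k ] ∣ ColorClassOf f j ∩ p ∣                            ≤⟨ ∑-mono-≤ small-classes ⟩
  ∑[ j < k ] b                                                    ≡⟨ ∑-const k b ⟩
  k * b                                                           ∎
  where
  open ≤-Reasoning
  in-own-class : ∀ x → indicator (x ∈? p) ≤ ∑[ j < k ] indicator (x ∈? ColorClassOf f j ∩ p)
  in-own-class x = ≤-trans
    (indicator-mono (x ∈? p) (x ∈? ColorClassOf f (f x) ∩ p) (λ x∈p → x∈p∩q⁺ (∈-tabulate⁺ (λ y → f y ≟ f x) refl , x∈p)))
    (term≤∑ (λ j → indicator (x ∈? ColorClassOf f j ∩ p)) (f x))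

∑∣Class∩p∣<∣p∣ : ∀ {n N} (d : Coloring n N) (p : Subset n) {a} → a ∈ p → d a ≡ nothing →
                 ∑[ k < N ] ∣ Class d k ∩ p ∣ < ∣ p ∣
∑∣Class∩p∣<∣p∣ {n} {N} d p {a} a∈p da≡nothing = begin-strict
  ∑[ k < N ] ∣ Class d k ∩ p ∣                             ≡⟨ sum-cong-≗ (λ k → ∣p∣≡count-∈ (Class d k ∩ p)) ⟩
  ∑[ k < N ] ∑[ x < n ] indicator (x ∈? Class d k ∩ p)  ≡⟨ ∑-comm (λ k x → indicator (x ∈? Class d k ∩ p)) ⟩
  ∑[ x < n ] count (λ k → x ∈? Class d k ∩ p)            ≤⟨ ∑-mono-≤ in-at-most-one-class ⟩
  count colored?                                           <⟨ count-< colored? (_∈? p) proj₁ a∈p (λ (_ , colored) → colored da≡nothing) ⟩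
  count (_∈? p)                                            ≡⟨ ∣p∣≡count-∈ p ⟨
  ∣ p ∣                                                    ∎
  where
  open ≤-Reasoning
  colored? : Decidable (λ x → x ∈ p × ¬ d x ≡ nothing)
  colored? x = x ∈? p ×-dec ¬? (Maybe.≡-dec _≟_ (d x) nothing)
  in-at-most-one-class : ∀ x → count (λ k → x ∈? Class d k ∩ p) ≤ indicator (colored? x)
  in-at-most-one-class x = at-most-one (colored? x)
    where
    color-of : ∀ {k} → x ∈ Class d k ∩ p → d x ≡ just k
    color-of x∈k = ∈-Class⁻ d (p∩q⊆p _ _ x∈k)
    at-most-one : (colored-x? : Dec (x ∈ p × ¬ d x ≡ nothing)) →
                  count (λ k → x ∈? Class d k ∩ p) ≤ indicator colored-x?
    at-most-one (yes _) = count≤1 (λ k → x ∈? Class d k ∩ p) λ x∈k x∈k′ →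
      Maybe.just-injective (trans (sym (color-of x∈k)) (color-of x∈k′))
    at-most-one (no uncolored) = ≤-reflexive (count-∅ (λ k → x ∈? Class d k ∩ p) λ x∈k →
      uncolored (p∩q⊆q _ _ x∈k , λ dx≡nothing → just≢nothing (trans (sym (color-of x∈k)) dx≡nothing)))
      where
      just≢nothing : ∀ {k} → ¬ just k ≡ nothing
      just≢nothing ()

-- Matroids

p⊆q-missing-two⇒2+∣p∣≤∣q∣ : ∀ {m} {p q : Subset m} {y w} → p ⊆ q → y ∈ q → y ∉ p → w ∈ q → w ∉ p →
                            ¬ w ≡ y → suc (suc ∣ p ∣) ≤ ∣ q ∣
p⊆q-missing-two⇒2+∣p∣≤∣q∣ {p = p} {q} {y} {w} p⊆q y∈q y∉p w∈q w∉p w≢y = ≤-trans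
  (s≤s (p⊂q⇒∣p∣<∣q∣ (p⊆q-y , w , x∈p∧x≢y⇒x∈p-y w∈q w≢y , w∉p)))
  (x∈p⇒∣p-x∣<∣p∣ y∈q)
  where
  p⊆q-y : p ⊆ q - y
  p⊆q-y {z} z∈p = x∈p∧x≢y⇒x∈p-y (p⊆q z∈p) (λ z≡y → y∉p (subst (_∈ p) z≡y z∈p))

p⊆q⇒p+x∪q⊆q+x : ∀ {m} {p q : Subset m} {x} → p ⊆ q → (p ∪ ⁅ x ⁆) ∪ q ⊆ q ∪ ⁅ x ⁆
p⊆q⇒p+x∪q⊆q+x {p = p} {q} {x} p⊆q w∈ with x∈p∪q⁻ (p ∪ ⁅ x ⁆) q w∈
... | inj₂ w∈q   = p⊆p∪q ⁅ x ⁆ w∈q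
... | inj₁ w∈p+x with x∈p∪q⁻ p ⁅ x ⁆ w∈p+x
...   | inj₁ w∈p = p⊆p∪q ⁅ x ⁆ (p⊆q w∈p)
...   | inj₂ w∈x = q⊆p∪q q ⁅ x ⁆ w∈x

misses-at-most-one : ∀ {m} {S J : Subset m} {x} → J ⊆ S ∪ ⁅ x ⁆ → x ∈ J → ∣ S ∣ ≤ ∣ J ∣ →
                     S ∪ ⁅ x ⁆ ⊆ J ⊎ ∃ λ y → y ∈ S × y ∉ J × (S ∩ ∁ ⁅ y ⁆) ∪ ⁅ x ⁆ ⊆ J
misses-at-most-one {S = S} {J} {x} J⊆S+x x∈J ∣S∣≤∣J∣ with any? (λ y → y ∈? S ×-dec ¬? (y ∈? J))
... | no S⊆J = inj₁ S+x⊆J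
  where
  S+x⊆J : S ∪ ⁅ x ⁆ ⊆ J
  S+x⊆J {w} w∈ with x∈p∪q⁻ S ⁅ x ⁆ w∈ | w ∈? J
  ... | _        | yes w∈J = w∈J
  ... | inj₁ w∈S | no w∉J  = contradiction (w , w∈S , w∉J) S⊆J
  ... | inj₂ w∈x | no w∉J  = contradiction (subst (_∈ J) (sym (x∈⁅y⁆⇒x≡y x w∈x)) x∈J) w∉J
... | yes (y , y∈S , y∉J) = inj₂ (y , y∈S , y∉J , S-y+x⊆J)
  where
  S-y+x⊆J : (S ∩ ∁ ⁅ y ⁆) ∪ ⁅ x ⁆ ⊆ J
  S-y+x⊆J {w} w∈ with x∈p∪q⁻ (S ∩ ∁ ⁅ y ⁆) ⁅ x ⁆ w∈ | w ∈? J
  ... | _          | yes w∈J = w∈J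
  ... | inj₂ w∈x   | no w∉J  = contradiction (subst (_∈ J) (sym (x∈⁅y⁆⇒x≡y x w∈x)) x∈J) w∉J
  ... | inj₁ w∈S-y | no w∉J  = contradiction ∣S∣≤∣J∣ (<⇒≱ (s≤s⁻¹ (≤-trans
        (p⊆q-missing-two⇒2+∣p∣≤∣q∣ J⊆S+x (p⊆p∪q ⁅ x ⁆ y∈S) y∉J (p⊆p∪q ⁅ x ⁆ w∈S) w∉J w≢y)
        (∣p∪⁅x⁆∣≤1+∣p∣ S x))))
    where
    w∈S : w ∈ S
    w∈S = proj₁ (x∈p∩q⁻ S (∁ ⁅ y ⁆) w∈S-y)
    w≢y : ¬ w ≡ y
    w≢y w≡y = x∈∁p⇒x∉p (proj₂ (x∈p∩q⁻ S (∁ ⁅ y ⁆) w∈S-y)) (subst (_∈ ⁅ y ⁆) (sym w≡y) (x∈⁅x⁆ y))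

module MatroidProperties {n : ℕ} (M : Matroid n) where
  open Matroid M

  Spans : Subset n → Fin n → Set
  Spans A x = x ∈ A ⊎ ¬ Indep (A ∪ ⁅ x ⁆)

  spans? : ∀ A → Decidable (Spans A)
  spans? A x = x ∈? A ⊎-dec ¬? (Indep? (A ∪ ⁅ x ⁆))

  span : Subset n → Subset n
  span A = tabulate (λ x → does (spans? A x))

  I⊆span[A]⇒∣I∣≤∣A∣ : ∀ {A I} → Indep A → Indep I → I ⊆ span A → ∣ I ∣ ≤ ∣ A ∣
  I⊆span[A]⇒∣I∣≤∣A∣ {A} {I} indep-A indep-I I⊆span with ∣ A ∣ <? ∣ I ∣
  ... | no ∣A∣≮∣I∣ = ≮⇒≥ ∣A∣≮∣I∣
  ... | yes ∣A∣<∣I∣ with indep-aug indep-A indep-I ∣A∣<∣I∣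
  ...   | z , z∈I , z∉A , indep-A+z with ∈-tabulate⁻ (spans? A) (I⊆span z∈I)
  ...     | inj₁ z∈A      = contradiction z∈A z∉A
  ...     | inj₂ dependent = contradiction indep-A+z dependent

  ∣span∣≤χ*∣A∣ : ∀ {χ A} → Colorable Indep χ → Indep A → ∣ span A ∣ ≤ χ * ∣ A ∣
  ∣span∣≤χ*∣A∣ {A = A} (f , f-indep) indep-A = ∣p∣≤k*b f (span A) λ j →
    I⊆span[A]⇒∣I∣≤∣A∣ indep-A (indep-↓ (p∩q⊆p _ _) (f-indep j)) (p∩q⊆q _ _)

  augment : ∀ k {I S} → Indep I → Indep S → ∣ S ∣ ≤ k + ∣ I ∣ →
            ∃ λ J → I ⊆ J × J ⊆ I ∪ S × Indep J × ∣ S ∣ ≤ ∣ J ∣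
  augment k {I} {S} indep-I indep-S fuel with ∣ I ∣ <? ∣ S ∣
  ... | no ∣I∣≮∣S∣ = I , ⊆-refl , p⊆p∪q S , indep-I , ≮⇒≥ ∣I∣≮∣S∣
  augment zero    indep-I indep-S fuel | yes ∣I∣<∣S∣ = contradiction fuel (<⇒≱ ∣I∣<∣S∣)
  augment (suc k) {I} {S} indep-I indep-S fuel | yes ∣I∣<∣S∣ with indep-aug indep-I indep-S ∣I∣<∣S∣
  ... | z , z∈S , z∉I , indep-I+z =
    let J , I+z⊆J , J⊆I+z∪S , indep-J , ∣S∣≤∣J∣ = augment k indep-I+z indep-S fuel′
    in  J , I+z⊆J ∘ p⊆p∪q ⁅ z ⁆ , J⊆I∪S ∘ J⊆I+z∪S , indep-J , ∣S∣≤∣J∣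
    where
    fuel′ : ∣ S ∣ ≤ k + ∣ I ∪ ⁅ z ⁆ ∣
    fuel′ = ≤-trans fuel (≤-trans (≤-reflexive (sym (+-suc k ∣ I ∣)))
              (+-monoʳ-≤ k (p⊂q⇒∣p∣<∣q∣ (p⊆p∪q ⁅ z ⁆ , z , q⊆p∪q I ⁅ z ⁆ (x∈⁅x⁆ z) , z∉I))))
    J⊆I∪S : (I ∪ ⁅ z ⁆) ∪ S ⊆ I ∪ S
    J⊆I∪S x∈ with x∈p∪q⁻ (I ∪ ⁅ z ⁆) S x∈
    ... | inj₂ x∈S = q⊆p∪q I S x∈S
    ... | inj₁ x∈I+z with x∈p∪q⁻ I ⁅ z ⁆ x∈I+z
    ...   | inj₁ x∈I = p⊆p∪q S x∈I
    ...   | inj₂ x∈z = q⊆p∪q I S (subst (_∈ S) (sym (x∈⁅y⁆⇒x≡y z x∈z)) z∈S)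

  exchange : ∀ {A S x} → A ⊆ S → Indep S → Indep (A ∪ ⁅ x ⁆) → x ∉ S → ¬ Indep (S ∪ ⁅ x ⁆) →
             ∃ λ y → y ∈ S × y ∉ A × Indep ((S ∩ ∁ ⁅ y ⁆) ∪ ⁅ x ⁆)
  exchange {A} {S} {x} A⊆S indep-S indep-A+x x∉S dependent
    with augment ∣ S ∣ indep-A+x indep-S (m≤m+n ∣ S ∣ _)
  ... | J , A+x⊆J , J⊆A+x∪S , indep-J , ∣S∣≤∣J∣
    with misses-at-most-one (p⊆q⇒p+x∪q⊆q+x A⊆S ∘ J⊆A+x∪S) (A+x⊆J (q⊆p∪q A ⁅ x ⁆ (x∈⁅x⁆ x))) ∣S∣≤∣J∣
  ... | inj₁ S+x⊆J                      = contradiction (indep-↓ S+x⊆J indep-J) dependent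
  ... | inj₂ (y , y∈S , y∉J , S-y+x⊆J) = y , y∈S , y∉J ∘ A+x⊆J ∘ p⊆p∪q ⁅ x ⁆ , indep-↓ S-y+x⊆J indep-J

-- Partition matroids

module PartitionMatroidProperties {n : ℕ} (P : PartitionMatroid n) where
  open PartitionMatroid P

  ∈-Part⁺ : ∀ {x q} → part x ≡ q → x ∈ Part q
  ∈-Part⁺ {q = q} = ∈-tabulate⁺ (λ y → part y ≟ q)

  ∈-Part⁻ : ∀ {x q} → x ∈ Part q → part x ≡ q
  ∈-Part⁻ {q = q} = ∈-tabulate⁻ (λ y → part y ≟ q)

  Indep-⊆ : ∀ {S T} → S ⊆ T → Indep T → Indep S
  Indep-⊆ {S} {T} S⊆T indep-T q = ≤-trans (p⊆q⇒∣p∣≤∣q∣ S∩Pq⊆T∩Pq) (indep-T q)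
    where
    S∩Pq⊆T∩Pq : S ∩ Part q ⊆ T ∩ Part q
    S∩Pq⊆T∩Pq x∈ = let x∈S , x∈Pq = x∈p∩q⁻ S (Part q) x∈ in x∈p∩q⁺ (S⊆T x∈S , x∈Pq)

  Indep-∪⁅⁆ : ∀ {S a} → Indep S → ∣ S ∩ Part (part a) ∣ < cap (part a) → Indep (S ∪ ⁅ a ⁆)
  Indep-∪⁅⁆ {S} {a} indep-S room q with part a ≟ q
  ... | yes refl = ≤-trans (p⊆q⇒∣p∣≤∣q∣ S+a∩Pq⊆S∩Pq+a) (≤-trans (∣p∪⁅x⁆∣≤1+∣p∣ (S ∩ Part q) a) room)
    where
    S+a∩Pq⊆S∩Pq+a : (S ∪ ⁅ a ⁆) ∩ Part q ⊆ (S ∩ Part q) ∪ ⁅ a ⁆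
    S+a∩Pq⊆S∩Pq+a x∈ with x∈p∩q⁻ (S ∪ ⁅ a ⁆) (Part q) x∈
    ... | x∈S+a , x∈Pq with x∈p∪q⁻ S ⁅ a ⁆ x∈S+a
    ...   | inj₁ x∈S = p⊆p∪q ⁅ a ⁆ (x∈p∩q⁺ (x∈S , x∈Pq))
    ...   | inj₂ x∈a = q⊆p∪q (S ∩ Part q) ⁅ a ⁆ x∈a
  ... | no a∉q = ≤-trans (p⊆q⇒∣p∣≤∣q∣ S+a∩Pq⊆S∩Pq) (indep-S q)
    where
    S+a∩Pq⊆S∩Pq : (S ∪ ⁅ a ⁆) ∩ Part q ⊆ S ∩ Part q
    S+a∩Pq⊆S∩Pq x∈ with x∈p∩q⁻ (S ∪ ⁅ a ⁆) (Part q) x∈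
    ... | x∈S+a , x∈Pq with x∈p∪q⁻ S ⁅ a ⁆ x∈S+a
    ...   | inj₁ x∈S = x∈p∩q⁺ (x∈S , x∈Pq)
    ...   | inj₂ x∈a = contradiction (trans (cong part (sym (x∈⁅y⁆⇒x≡y a x∈a))) (∈-Part⁻ x∈Pq)) a∉q

  ∣Part∣≤χ*cap : ∀ {χ} → Colorable Indep χ → ∀ q → ∣ Part q ∣ ≤ χ * cap q
  ∣Part∣≤χ*cap (f , f-indep) q = ∣p∣≤k*b f (Part q) (λ j → f-indep j q)

  module _ {N : ℕ} where

    Saturated : Coloring n N → Fin n → Fin N → Set
    Saturated d a k = cap (part a) ≤ ∣ Class d k ∩ Part (part a) ∣

    saturated? : ∀ d a → Decidable (Saturated d a)
    saturated? d a k = cap (part a) ≤? ∣ Class d k ∩ Part (part a) ∣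

    count-saturated<χ : ∀ {χ d a} → Colorable Indep χ → d a ≡ nothing → count (saturated? d a) < χ
    count-saturated<χ {χ} {d} {a} colorable da≡nothing = *-cancelˡ-< (cap q) _ _ (begin-strict
      cap q * count (saturated? d a)    ≤⟨ *-count≤∑ (saturated? d a) (cap q) (λ k → ∣ Class d k ∩ Part q ∣) (λ sat → sat) ⟩
      ∑[ k < N ] ∣ Class d k ∩ Part q ∣  <⟨ ∑∣Class∩p∣<∣p∣ d (Part q) (∈-Part⁺ refl) da≡nothing ⟩
      ∣ Part q ∣                         ≤⟨ ∣Part∣≤χ*cap colorable q ⟩
      χ * cap q                          ≡⟨ *-comm χ (cap q) ⟩
      cap q * χ                          ∎)
      where
      open ≤-Reasoning
      q : Fin #parts
      q = part a

    feasible-after-coloring : ∀ d e {a} (κ : Maybe (Fin N)) → Feasible Indep d →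
      (∀ {k x} → x ∈ Class e k → x ∈ Class d k ⊎ (x ≡ a × κ ≡ just k)) →
      (∀ {k} → κ ≡ just k → ¬ Saturated d a k) → Feasible Indep e
    feasible-after-coloring d e {a} κ d-feasible e⊆d+a unsaturated k
      with Maybe.≡-dec _≟_ κ (just k)
    ... | yes κ≡k = Indep-⊆ e⊆d∪a (Indep-∪⁅⁆ {Class d k} (d-feasible k) (≰⇒> (unsaturated κ≡k)))
      where
      e⊆d∪a : Class e k ⊆ Class d k ∪ ⁅ a ⁆
      e⊆d∪a x∈ with e⊆d+a x∈
      ... | inj₁ x∈d       = p⊆p∪q ⁅ a ⁆ x∈d
      ... | inj₂ (refl , _) = q⊆p∪q (Class d k) ⁅ a ⁆ (x∈⁅x⁆ _)
    ... | no κ≢k = Indep-⊆ e⊆d (d-feasible k)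
      where
      e⊆d : Class e k ⊆ Class d k
      e⊆d x∈ with e⊆d+a x∈
      ... | inj₁ x∈d       = x∈d
      ... | inj₂ (_ , κ≡k) = contradiction κ≡k κ≢k

SaturatedSomewhere : ∀ {n N m} → (Fin m → PartitionMatroid n) → Coloring n N → Fin n → Fin N → Set
SaturatedSomewhere Ms d a k = ∃ λ i → PartitionMatroidProperties.Saturated (Ms i) d a k

saturatedSomewhere? : ∀ {n N m} (Ms : Fin m → PartitionMatroid n) d a → Decidable (SaturatedSomewhere {n} {N} Ms d a)
saturatedSomewhere? Ms d a k = any? λ i → PartitionMatroidProperties.saturated? (Ms i) d a k

count-saturatedSomewhere≤sumPred :
  ∀ {n N m} (Ms : Fin m → PartitionMatroid n) (χs : Fin m → ℕ) →
  (∀ i → Colorable (PartitionMatroid.Indep (Ms i)) (χs i)) →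
  (d : Coloring n N) {a : Fin n} → d a ≡ nothing → count (saturatedSomewhere? Ms d a) ≤ sumPred χs
count-saturatedSomewhere≤sumPred {m = m} Ms χs colorable d {a} da≡nothing = begin
  count (saturatedSomewhere? Ms d a)       ≤⟨ count-∃ (λ i → PM.saturated? i d a) ⟩
  ∑[ i < m ] count (PM.saturated? i d a)  ≤⟨ ∑-mono-≤ (λ i → <⇒≤∸1 (PM.count-saturated<χ i {d = d} (colorable i) da≡nothing)) ⟩
  ∑[ i < m ] (χs i ∸ 1)                    ≡⟨ sumPred≡∑ χs ⟨
  sumPred χs                                ∎
  where
  open ≤-Reasoning
  module PM i = PartitionMatroidProperties (Ms i)
  <⇒≤∸1 : ∀ {k χ} → k < χ → k ≤ χ ∸ 1
  <⇒≤∸1 (s≤s k≤χ-1) = k≤χ-1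

-- Layers of the Edmonds digraph

module Layering {n N : ℕ} (M₁ : Matroid n) (B : ℕ) (c : Coloring n N) where
  open Matroid M₁
  open Edmonds M₁ B c

  arc? : ∀ v w → Dec (Arc v w)
  arc? (inj₁ j) (inj₂ x) = ¬? (x ∈? S j) ×-dec Indep? (S j ∪ ⁅ x ⁆)
  arc? (inj₂ y) (inj₂ x) = any? λ j →
    ¬? (x ∈? S j) ×-dec ¬? (Indep? (S j ∪ ⁅ x ⁆)) ×-dec y ∈? S j ×-dec Indep? ((S j ∩ ∁ ⁅ y ⁆) ∪ ⁅ x ⁆)
  arc? (inj₁ _) (inj₁ _) = no λ ()
  arc? (inj₂ _) (inj₁ _) = no λ ()

  arc-source-colored : ∀ {w v} → Arc w v → ∃ λ k → colorOf w ≡ just k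
  arc-source-colored {inj₁ j}          _                     = j , refl
  arc-source-colored {inj₂ y} {inj₂ x} (j , _ , _ , y∈S , _) = j , ∈-Class⁻ c y∈S

  ∃-vertex? : ∀ {P : Vertex n N → Set} → Decidable P → Dec (∃ P)
  ∃-vertex? P? with any? (P? ∘ inj₁) | any? (P? ∘ inj₂)
  ... | yes (j , Pj) | _            = yes (inj₁ j , Pj)
  ... | no _         | yes (x , Px) = yes (inj₂ x , Px)
  ... | no ¬Pj       | no ¬Px       = no λ { (inj₁ j , Pj) → ¬Pj (j , Pj) ; (inj₂ x , Px) → ¬Px (x , Px) }

  EntryColor : (Vertex n N → Set) → Vertex n N → Fin N → Set
  EntryColor E v k = ∃ λ w → E w × Arc w v × colorOf w ≡ just k

  entryColor? : ∀ {E} → Decidable E → ∀ v → Decidable (EntryColor E v)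
  entryColor? E? v k = ∃-vertex? λ w → E? w ×-dec arc? w v ×-dec Maybe.≡-dec _≟_ (colorOf w) (just k)

  module _ {E : Vertex n N → Set} (E? : Decidable E) {v : Vertex n N} where

    ManyColors⇒B<count : ManyColors E v → B < count (entryColor? E? v)
    ManyColors⇒B<count (y , E-y , arcs , distinct) =
      injection⇒≤count (entryColor? E? v) color color-injective
        (λ s → y s , E-y s , arcs s , proj₂ (arc-source-colored (arcs s)))
      where
      color : Fin (suc B) → Fin N
      color s = proj₁ (arc-source-colored (arcs s))
      color-injective : Injective _≡_ _≡_ color
      color-injective {s} {s′} eq = distinct (trans (proj₂ (arc-source-colored (arcs s)))
                                        (trans (cong just eq) (sym (proj₂ (arc-source-colored (arcs s′))))))

    B<count⇒ManyColors : B < count (entryColor? E? v) → ManyColors E v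
    B<count⇒ManyColors B<count with ≤count⇒injection (entryColor? E? v) B<count
    ... | color , color-injective , entry =
      (λ s → proj₁ (entry s)) , (λ s → proj₁ (proj₂ (entry s))) , (λ s → proj₁ (proj₂ (proj₂ (entry s)))) ,
      λ {s} {s′} eq → color-injective (Maybe.just-injective (trans (sym (source-color s)) (trans eq (source-color s′))))
      where
      source-color : ∀ s → colorOf (proj₁ (entry s)) ≡ just (color s)
      source-color s = proj₂ (proj₂ (proj₂ (entry s)))

  manyColors? : ∀ {E} → Decidable E → Decidable (ManyColors E)
  manyColors? E? v = map′ (B<count⇒ManyColors E?) (ManyColors⇒B<count E?) (suc B ≤? count (entryColor? E? v))

  ManyColors-mono : ∀ {E E′ : Vertex n N → Set} {v} → (∀ w → E w → E′ w) → ManyColors E v → ManyColors E′ v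
  ManyColors-mono E⊆E′ (y , E-y , arcs , distinct) = y , (λ s → E⊆E′ (y s) (E-y s)) , arcs , distinct

  before? : ∀ t → Decidable (Before t)
  inLayer? : ∀ t → Decidable (InLayer t)
  before? zero    v = no λ ()
  before? (suc t) v = before? t v ⊎-dec inLayer? t v
  inLayer? zero    (inj₁ _) = yes tt
  inLayer? zero    (inj₂ _) = no λ ()
  inLayer? (suc t) v        = ¬? (before? (suc t) v) ×-dec manyColors? (before? (suc t)) v

  InLayer⇒Before : ∀ {t t′ v} → t < t′ → InLayer t v → Before t′ v
  InLayer⇒Before {t} {suc t′} (s≤s t≤t′) v∈Lt with m≤n⇒m<n∨m≡n t≤t′
  ... | inj₁ t<t′ = inj₁ (InLayer⇒Before t<t′ v∈Lt)
  ... | inj₂ refl = inj₂ v∈Lt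

  Before⇒InLayer : ∀ {t v} → Before t v → ∃ λ t′ → InLayer t′ v
  Before⇒InLayer {suc t} (inj₁ before) = Before⇒InLayer before
  Before⇒InLayer {suc t} (inj₂ v∈Lt)   = t , v∈Lt

  ¬InLayer-later : ∀ {t t′ v} → t < t′ → InLayer t v → ¬ InLayer t′ v
  ¬InLayer-later {t′ = suc _} t<t′ v∈Lt (not-before , _) = not-before (InLayer⇒Before t<t′ v∈Lt)

  InLayer-unique : ∀ {t t′ v} → InLayer t v → InLayer t′ v → t ≡ t′
  InLayer-unique {t} {t′} v∈Lt v∈Lt′ with <-cmp t t′
  ... | tri< t<t′ _ _ = contradiction v∈Lt′ (¬InLayer-later t<t′ v∈Lt)
  ... | tri≈ _ t≡t′ _ = t≡t′
  ... | tri> _ _ t′<t = contradiction v∈Lt (¬InLayer-later t′<t v∈Lt′)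

  empty-layer-persists : ∀ t → (∀ v → ¬ InLayer (suc t) v) → ∀ v → ¬ InLayer (suc (suc t)) v
  empty-layer-persists t empty v (not-before , many) =
    empty v (not-before ∘ inj₁ , ManyColors-mono (λ w → skip-empty-layer {w}) many)
    where
    skip-empty-layer : ∀ {w} → Before (suc (suc t)) w → Before (suc t) w
    skip-empty-layer (inj₁ before) = before
    skip-empty-layer (inj₂ w∈L)    = contradiction w∈L (empty _)

  layer-below : ∀ {t v} → InLayer (suc t) v → ∀ {k} → k ≤ t → ∃ λ w → InLayer (suc k) w
  layer-below {zero}  v∈L z≤n = _ , v∈L
  layer-below {suc t} v∈L k≤1+t with m≤n⇒m<n∨m≡n k≤1+t | ∃-vertex? (inLayer? (suc t))
  ... | inj₂ refl  | _             = _ , v∈L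
  ... | inj₁ k<1+t | yes (w , w∈L) = layer-below w∈L (s≤s⁻¹ k<1+t)
  ... | inj₁ _     | no empty      =
    contradiction v∈L (empty-layer-persists t (λ w w∈L → empty (w , w∈L)) _)

  vertex-index : Vertex n N → Fin (N + n)
  vertex-index = join N n

  vertex-index-injective : Injective _≡_ _≡_ vertex-index
  vertex-index-injective {v} {w} eq =
    trans (sym (splitAt-join N n v)) (trans (cong (splitAt N) eq) (splitAt-join N n w))

  -- Layers 1, …, t are nonempty and pairwise disjoint.
  layer-bound : ∀ {t v} → InLayer t v → t ≤ N + n
  layer-bound {zero}  _   = z≤n
  layer-bound {suc t} v∈L = injective⇒≤ {f = vertex-index ∘ proj₁ ∘ witness} λ {i} {j} eq →
    toℕ-injective (suc-injective (InLayer-unique (proj₂ (witness i))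
      (subst (InLayer (suc (toℕ j))) (sym (vertex-index-injective eq)) (proj₂ (witness j)))))
    where
    witness : (i : Fin (suc t)) → ∃ λ w → InLayer (suc (toℕ i)) w
    witness i = layer-below v∈L (s≤s⁻¹ (toℕ<n i))

  Layered : Vertex n N → Set
  Layered v = ∃ λ t → InLayer t v

  Layered⇒Before : ∀ {v} → Layered v → Before (suc (N + n)) v
  Layered⇒Before (t , v∈L) = InLayer⇒Before (s≤s (layer-bound v∈L)) v∈L

  layered? : Decidable Layered
  layered? v = map′ Before⇒InLayer Layered⇒Before (before? (suc (N + n)) v)

  layered-closed : ∀ {v} → ManyColors Layered v → Layered v
  layered-closed {v} many with before? (suc (N + n)) v
  ... | yes before    = Before⇒InLayer before
  ... | no not-before = suc (N + n) , not-before , ManyColors-mono (λ w → Layered⇒Before {w}) many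

  layered-element : ∀ {x} → Layered (inj₂ x) → ∃ λ t → InLayer (suc t) (inj₂ x)
  layered-element (suc t , x∈L) = t , x∈L

module ColorChordless {n N : ℕ} (M₁ : Matroid n) (B : ℕ) (c : Coloring n N)
  (HArc : Vertex n N → Vertex n N → Set) (chordless : Edmonds.IsColorChordless M₁ B c HArc) where
  open Edmonds M₁ B c
  open Layering M₁ B c

  HArc-target-layer : ∀ {w x} → HArc w x → ∃ λ t → InLayer (suc t) x
  HArc-target-layer {w} {x} arc with layered? x
  ... | no unlayered      = contradiction arc (proj₁ (chordless x) (λ t x∈L → unlayered (suc t , x∈L)) w)
  ... | yes (suc t , x∈L) = t , x∈L
  ... | yes (zero , x∈L₀) =
    contradiction arc (proj₁ (chordless x) (λ t x∈L → 0≢1+n (InLayer-unique x∈L₀ x∈L)) w)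

  HArc-source-layered : ∀ {w x} → HArc w x → Layered w
  HArc-source-layered {w} {x} arc =
    let t , x∈L                               = HArc-target-layer arc
        _ , _ , _ , _ , chordless-at , H-arcs = proj₂ (chordless x) t x∈L
        s , w≡yₛ                              = proj₁ (H-arcs w) arc
        tₛ , yₛ∈L , _                         = chordless-at s
    in  tₛ , subst (InLayer tₛ) (sym w≡yₛ) yₛ∈L

  H-in-neighbours : ∀ {t x} → InLayer (suc t) x →
    Σ (Fin (suc B) → Vertex n N) λ y → (∀ s → HArc (y s) x) ×
    Σ (Fin (suc B) → Fin N) λ color → Injective _≡_ _≡_ color × (∀ s → colorOf (y s) ≡ just (color s))
  H-in-neighbours {t} {x} x∈L =
    let y , _ , arcs , distinct , _ , H-arcs = proj₂ (chordless x) t x∈L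
        color s = proj₁ (arc-source-colored (arcs s))
        colorOf-y s = proj₂ (arc-source-colored (arcs s))
    in  y , (λ s → proj₂ (H-arcs (y s)) s refl) ,
        color , (λ {s} {s′} eq → distinct (trans (colorOf-y s) (trans (cong just eq) (sym (colorOf-y s′))))) ,
        colorOf-y

  walk-head-layered : ∀ {a u} xs → (c u ≡ nothing → Layered (inj₂ u)) →
                      IsWalk HArc (inj₂ a ∷ xs) → last (inj₂ a ∷ xs) ≡ just (inj₂ u) → c u ≡ nothing →
                      Layered (inj₂ a)
  walk-head-layered []      uncolored⇒layered _          refl cu = uncolored⇒layered cu
  walk-head-layered (_ ∷ _) _                 (arc , _) _    _  = HArc-source-layered arc

module UncoloredElements {n α B : ℕ} (M₁ : Matroid n) (c : Coloring n (α + B))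
  (c-feasible : Feasible (Matroid.Indep M₁) c) where
  open Matroid M₁
  open MatroidProperties M₁
  open Edmonds M₁ B c
  open Layering M₁ B c

  unlayered? : Decidable (λ x → ¬ Layered (inj₂ x))
  unlayered? x = ¬? (layered? (inj₂ x))

  Unlayered : Subset n
  Unlayered = tabulate (λ x → does (unlayered? x))

  A : Fin (α + B) → Subset n
  A j = S j ∩ Unlayered

  layered-outside-A : ∀ {y j} → y ∈ S j → y ∉ A j → Layered (inj₂ y)
  layered-outside-A {y} y∈S y∉A with layered? (inj₂ y)
  ... | yes layered  = layered
  ... | no unlayered = contradiction (x∈p∩q⁺ (y∈S , ∈-tabulate⁺ unlayered? unlayered)) y∉A

  -- If A j ∪ ⁅x⁆ were independent, exchange would give an arc into x from a layered element of colour j.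
  unreached-color⇒spans : ∀ {x j} → x ∈ Unlayered → ¬ EntryColor Layered (inj₂ x) j → Spans (A j) x
  unreached-color⇒spans {x} {j} x∈U unreached with x ∈? S j
  ... | yes x∈S = inj₁ (x∈p∩q⁺ (x∈S , x∈U))
  ... | no x∉S  = inj₂ λ indep-A+x →
    let y , y∈S , y∉A , indep-S-y+x = exchange (p∩q⊆p (S j) Unlayered) (c-feasible j) indep-A+x x∉S dependent
    in  unreached (inj₂ y , layered-outside-A y∈S y∉A , (j , x∉S , dependent , y∈S , indep-S-y+x) , ∈-Class⁻ c y∈S)
    where
    dependent : ¬ Indep (S j ∪ ⁅ x ⁆)
    dependent indep-S+x = unreached (inj₁ j , (0 , tt) , (x∉S , indep-S+x) , refl)

  α≤#spanning-classes : ∀ {x} → x ∈ Unlayered → α ≤ count (λ j → spans? (A j) x)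
  α≤#spanning-classes {x} x∈U = ≤-trans α≤#unreached
    (count-mono (¬? ∘ reached?) (λ j → spans? (A j) x) (unreached-color⇒spans x∈U))
    where
    reached? : Decidable (EntryColor Layered (inj₂ x))
    reached? = entryColor? layered? (inj₂ x)
    few-reached : count reached? ≤ B
    few-reached = ≮⇒≥ λ many → ∈-tabulate⁻ unlayered? x∈U
                                 (layered-closed (B<count⇒ManyColors layered? many))
    α≤#unreached : α ≤ count (¬? ∘ reached?)
    α≤#unreached = +-cancelʳ-≤ B α _ (begin
      α + B                                   ≡⟨ count-complement reached? ⟨
      count reached? + count (¬? ∘ reached?)  ≤⟨ +-monoˡ-≤ _ few-reached ⟩
      B + count (¬? ∘ reached?)               ≡⟨ +-comm B _ ⟩
      count (¬? ∘ reached?) + B               ∎)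
      where open ≤-Reasoning

  uncolored-layered : Colorable Indep α → ∀ {u} → c u ≡ nothing → Layered (inj₂ u)
  uncolored-layered (f , f-indep) {u} cu≡nothing with layered? (inj₂ u)
  ... | yes layered  = layered
  ... | no unlayered = contradiction (*-cancelˡ-≤ α ⦃ nonZeroIndex (f u) ⦄ α∣U∣≤α∑∣A∣) (<⇒≱ ∑∣A∣<∣U∣)
    where
    open ≤-Reasoning
    ∑∣A∣<∣U∣ : ∑[ j < α + B ] ∣ A j ∣ < ∣ Unlayered ∣
    ∑∣A∣<∣U∣ = ∑∣Class∩p∣<∣p∣ c Unlayered (∈-tabulate⁺ unlayered? unlayered) cu≡nothing
    α∣U∣≤α∑∣A∣ : α * ∣ Unlayered ∣ ≤ α * ∑[ j < α + B ] ∣ A j ∣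
    α∣U∣≤α∑∣A∣ = begin
      α * ∣ Unlayered ∣                              ≡⟨ cong (α *_) (∣p∣≡count-∈ Unlayered) ⟩
      α * count (_∈? Unlayered)                      ≤⟨ *-count≤∑ (_∈? Unlayered) α _ α≤#spanning-classes ⟩
      ∑[ x < n ] count (λ j → spans? (A j) x)        ≡⟨ ∑-comm (λ x j → indicator (spans? (A j) x)) ⟩
      ∑[ j < α + B ] count (spans? (A j))            ≡⟨ sum-cong-≗ (λ j → ∣tabulate∣≡count (spans? (A j))) ⟨
      ∑[ j < α + B ] ∣ span (A j) ∣                  ≤⟨ ∑-mono-≤ (λ j → ∣span∣≤χ*∣A∣ (f , f-indep) (indep-↓ (p∩q⊆p _ _) (c-feasible j))) ⟩
      ∑[ j < α + B ] (α * ∣ A j ∣)                   ≡⟨ *-distribˡ-sum α (λ j → ∣ A j ∣) ⟨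
      α * ∑[ j < α + B ] ∣ A j ∣                     ∎

-- Recolouring along a path

update-same : ∀ {n N} (d : Coloring n N) a v → update d a v a ≡ v
update-same d a v with a ≟ a
... | yes _  = refl
... | no a≢a = contradiction refl a≢a

update-other : ∀ {n N} (d : Coloring n N) {a x} v → ¬ x ≡ a → update d a v x ≡ d x
update-other d {a} {x} v x≢a with x ≟ a
... | yes x≡a = contradiction x≡a x≢a
... | no _    = refl

module Recoloring {n N : ℕ} (M₁ : Matroid n) (B : ℕ) (c : Coloring n N) where
  open Edmonds M₁ B c

  paint : Vertex n N → Maybe (Fin N) → Coloring n N → Coloring n N
  paint (inj₁ _) _ d = d
  paint (inj₂ x) v d = update d x v

  -- Δ runs a loop that Defs keeps private; recolor is that loop, found by unification in the
  -- proof of Δ-element-head (abstracting the head vertex makes the constraint a pattern).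
  mutual
    recolor : Vertex n N → List (Vertex n N) → Coloring n N → Coloring n N
    recolor = _

    Δ-element-head : ∀ a xs → Δ (inj₂ a ∷ xs) ≡ recolor (inj₂ a) xs (update c a nothing)
    Δ-element-head a xs with inj₂ {A = Fin N} a | update c a nothing
    ... | p | d = refl

  Δ-extend : ∀ z a xs → Δ (z ∷ inj₂ a ∷ xs) ≡ recolor (inj₂ a) xs (update (paint z nothing c) a (colorOf z))
  Δ-extend (inj₁ _) _ _ = refl
  Δ-extend (inj₂ _) _ _ = refl

  recolor-overwrites-or-keeps : ∀ p ws x →
    (∀ d e → recolor p ws d x ≡ recolor p ws e x) ⊎ (∀ d → recolor p ws d x ≡ d x)
  recolor-overwrites-or-keeps p []            x = inj₂ λ _ → refl
  recolor-overwrites-or-keeps p (inj₁ j ∷ ws) x = recolor-overwrites-or-keeps (inj₁ j) ws x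
  recolor-overwrites-or-keeps p (inj₂ y ∷ ws) x with recolor-overwrites-or-keeps (inj₂ y) ws x | x ≟ y
  ... | inj₁ overwritten | _        = inj₁ λ d e → overwritten _ _
  ... | inj₂ kept        | yes refl = inj₁ λ d e →
    trans (kept _) (trans (update-same d x _) (sym (trans (kept _) (update-same e x _))))
  ... | inj₂ kept        | no x≢y   = inj₂ λ d → trans (kept _) (update-other d _ x≢y)

  recolor-keeps-absent : ∀ p ws d {x} → All (λ w → ¬ inj₂ x ≡ w) ws → recolor p ws d x ≡ d x
  recolor-keeps-absent p []            d []             = refl
  recolor-keeps-absent p (inj₁ j ∷ ws) d (_ ∷ absent)   = recolor-keeps-absent (inj₁ j) ws d absent
  recolor-keeps-absent p (inj₂ y ∷ ws) d (x≢y ∷ absent) =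
    trans (recolor-keeps-absent (inj₂ y) ws _ absent) (update-other d _ (x≢y ∘ cong inj₂))

  Δ-head-uncolored : ∀ {a xs} → All (λ w → ¬ inj₂ a ≡ w) xs → Δ (inj₂ a ∷ xs) a ≡ nothing
  Δ-head-uncolored {a} {xs} absent = begin
    Δ (inj₂ a ∷ xs) a                             ≡⟨ cong-app (Δ-element-head a xs) a ⟩
    recolor (inj₂ a) xs (update c a nothing) a    ≡⟨ recolor-keeps-absent (inj₂ a) xs _ absent ⟩
    update c a nothing a                          ≡⟨ update-same c a nothing ⟩
    nothing                                       ∎
    where open ≡-Reasoning

  paint-nothing : ∀ z d x → paint z nothing d x ≡ d x ⊎ paint z nothing d x ≡ nothing
  paint-nothing (inj₁ _) d x = inj₁ refl
  paint-nothing (inj₂ y) d x = by-cases (x ≟ y)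
    where
    by-cases : Dec (x ≡ y) → update d y nothing x ≡ d x ⊎ update d y nothing x ≡ nothing
    by-cases (yes refl) = inj₂ (update-same d x nothing)
    by-cases (no x≢y)   = inj₁ (update-other d nothing x≢y)

  Δ-extend-pointwise : ∀ z a xs x →
    let e = Δ (z ∷ inj₂ a ∷ xs) in e x ≡ Δ (inj₂ a ∷ xs) x ⊎ e x ≡ nothing ⊎ (x ≡ a × e x ≡ colorOf z)
  Δ-extend-pointwise z a xs x =
    [ (λ overwritten → inj₁ (trans e≡recolor (overwritten base orig)))
    , (λ kept → kept-case (x ≟ a) (trans e≡recolor (kept base)) (kept orig))
    ]′ (recolor-overwrites-or-keeps (inj₂ a) xs x)
    where
    base orig : Coloring n N
    base = update (paint z nothing c) a (colorOf z)
    orig = update c a nothing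
    e : Coloring n N
    e = Δ (z ∷ inj₂ a ∷ xs)
    e≡recolor : e x ≡ recolor (inj₂ a) xs base x
    e≡recolor = cong-app (Δ-extend z a xs) x
    kept-case : Dec (x ≡ a) → e x ≡ base x → Δ (inj₂ a ∷ xs) x ≡ orig x →
                e x ≡ Δ (inj₂ a ∷ xs) x ⊎ e x ≡ nothing ⊎ (x ≡ a × e x ≡ colorOf z)
    kept-case (yes refl) e≡base _ = inj₂ (inj₂ (refl , trans e≡base (update-same _ x _)))
    kept-case (no x≢a) e≡base d≡orig with paint-nothing z c x
    ... | inj₁ unchanged = inj₁ (trans e≡base (trans (update-other _ _ x≢a)
                             (trans unchanged (sym (trans d≡orig (update-other c _ x≢a))))))
    ... | inj₂ uncolored = inj₂ (inj₁ (trans e≡base (trans (update-other _ _ x≢a) uncolored)))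

  Δ-extend-classes : ∀ z a xs {k x} → x ∈ Class (Δ (z ∷ inj₂ a ∷ xs)) k →
                     x ∈ Class (Δ (inj₂ a ∷ xs)) k ⊎ (x ≡ a × colorOf z ≡ just k)
  Δ-extend-classes z a xs {k} {x} x∈ with Δ-extend-pointwise z a xs x | ∈-Class⁻ (Δ (z ∷ inj₂ a ∷ xs)) x∈
  ... | inj₁ same                   | ex≡k = inj₁ (∈-Class⁺ (Δ (inj₂ a ∷ xs)) (trans (sym same) ex≡k))
  ... | inj₂ (inj₁ uncolored)       | ex≡k = contradiction (trans (sym uncolored) ex≡k) λ ()
  ... | inj₂ (inj₂ (x≡a , colored)) | ex≡k = inj₂ (x≡a , trans (sym colored) ex≡k)

  SuffixFeasible-∷ : ∀ {I : Subset n → Set} {z P} →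
                     Feasible I (Δ (z ∷ P)) → SuffixFeasible I P → SuffixFeasible I (z ∷ P)
  SuffixFeasible-∷ feasible _        zero    _     = feasible
  SuffixFeasible-∷ _        suffixes (suc s) s<len = suffixes s (s≤s⁻¹ s<len)

lemma4p6 :
    ∀ {n : ℕ} (M₁ : Matroid n) (m : ℕ) (Ms : Fin m → PartitionMatroid n)
      (α : ℕ) (χs : Fin m → ℕ) →
    IsChromaticNumber (Matroid.Indep M₁) α →
    (∀ i → IsChromaticNumber (PartitionMatroid.Indep (Ms i)) (χs i)) →
    (c : Coloring n (α + sumPred χs)) →
    Feasible (Matroid.Indep M₁) c →
    (∀ i → Feasible (PartitionMatroid.Indep (Ms i)) c) →
    (HArc : Vertex n (α + sumPred χs) → Vertex n (α + sumPred χs) → Set) →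
    Edmonds.IsColorChordless M₁ (sumPred χs) c HArc →
    (a : Fin n) (xs : List (Vertex n (α + sumPred χs))) (u : Fin n) →
    Edmonds.IsWalk M₁ (sumPred χs) c HArc (inj₂ a ∷ xs) →
    Unique (inj₂ a ∷ xs) →
    last (inj₂ a ∷ xs) ≡ just (inj₂ u) →
    c u ≡ nothing →
    (∀ i → Edmonds.SuffixFeasible M₁ (sumPred χs) c
             (PartitionMatroid.Indep (Ms i)) (inj₂ a ∷ xs)) →
    ∃ λ z → HArc z (inj₂ a)
      × (∀ i → Edmonds.SuffixFeasible M₁ (sumPred χs) c
                 (PartitionMatroid.Indep (Ms i)) (z ∷ inj₂ a ∷ xs))
lemma4p6 {n} M₁ m Ms α χs (α-colorable , _) χs-chromatic c c-feasible _ HArc chordless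
         a xs u walk (a∉xs ∷ _) last≡u cu≡nothing suffix-feasible =
  let _ , a∈L = layered-element (walk-head-layered xs (uncolored-layered α-colorable) walk last≡u cu≡nothing)
      y , H-arcs , color , color-injective , colorOf-y = H-in-neighbours a∈L
      s , nowhere-saturated = injection-escapes (saturatedSomewhere? Ms d a) color color-injective
                                (count-saturatedSomewhere≤sumPred Ms χs (proj₁ ∘ χs-chromatic) d da≡nothing)
      unsaturated : ∀ i {k} → colorOf (y s) ≡ just k → ¬ PM.Saturated i d a k
      unsaturated i ys≡k saturated = nowhere-saturated
        (i , subst (PM.Saturated i d a) (Maybe.just-injective (trans (sym ys≡k) (colorOf-y s))) saturated)
  in  y s , H-arcs s , λ i → SuffixFeasible-∷ {I = PartitionMatroid.Indep (Ms i)}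
        (PM.feasible-after-coloring i d (Δ (y s ∷ inj₂ a ∷ xs)) (colorOf (y s)) (suffix-feasible i 0 (s≤s z≤n))
          (Δ-extend-classes (y s) a xs) (unsaturated i))
        (suffix-feasible i)
  where
  B : ℕ
  B = sumPred χs
  open Edmonds M₁ B c
  open Layering M₁ B c
  open ColorChordless M₁ B c HArc chordless
  open UncoloredElements {α = α} {B = B} M₁ c c-feasible
  open Recoloring M₁ B c
  module PM i = PartitionMatroidProperties (Ms i)

  d : Coloring n (α + B)
  d = Δ (inj₂ a ∷ xs)

  da≡nothing : d a ≡ nothing
  da≡nothing = Δ-head-uncolored a∉xs
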